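{- Let $G$ be an $r_1$-regular graph on $s_1$ vertices and $H$ an $r_2$-regular graph on $s_2$ vertices (finite, simple, undirected). Then $$Mo(G+H)=s_1s_2\,|s_2-s_1+r_1-r_2| .$$
   Context: For a graph $X$ and an edge $e=uv$ of $X$, $n_u(e\mid X)$ denotes the number of vertices $w$ of $X$ with $d_X(w,u)<d_X(w,v)$ ($d_X$ the shortest-path distance). The Mostar index is $Mo(X)=\sum_{uv\in E(X)}|n_u(e\mid X)-n_v(e\mid X)|$. The join $G+H$ is the disjoint union of $G$ and $H$ together with all edges joining a vertex of $G$ to a vertex of $H$. -}

module Defs where

open import Data.Bool using (Bool; true; false; _∧_; _∨_; if_then_else_; not)
open import Data.Nat using (ℕ; zero; suc; _+_; _<ᵇ_; ∣_-_∣)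
open import Data.Fin using (Fin; toℕ; splitAt; _≟_)
open import Data.Sum using (inj₁; inj₂)
open import Data.List using (List; map; allFin; concatMap)
open import Data.Nat.ListAction using (sum)
open import Data.Bool.ListAction using (any)
open import Data.Maybe using (Maybe; just; nothing)
open import Relation.Nullary.Decidable using (isYes)
open import Relation.Binary.PropositionalEquality using (_≡_; refl)

record Graph (n : ℕ) : Set where
  field
    adj   : Fin n → Fin n → Bool
    sym   : ∀ u v → adj u v ≡ adj v u
    irrefl : ∀ v → adj v v ≡ false
open Graph public

count : {n : ℕ} → (Fin n → Bool) → ℕ
count {n} p = sum (map (λ w → if p w then 1 else 0) (allFin n))

degree : {n : ℕ} → Graph n → Fin n → ℕ
degree X v = count (adj X v)

Regular : {n : ℕ} → Graph n → ℕ → Set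
Regular X r = ∀ v → degree X v ≡ r

reach : {n : ℕ} → Graph n → ℕ → Fin n → Fin n → Bool
reach X zero    u v = isYes (u ≟ v)
reach {n} X (suc k) u v =
  reach X k u v ∨ any (λ w → reach X k u w ∧ adj X w v) (allFin n)

-- shortest-path distance: least k with a walk of length ≤ k;
-- nothing (= ∞) if v is unreachable from u (searching k ≤ n suffices,
-- since a shortest walk has length < n).
dist : {n : ℕ} → Graph n → Fin n → Fin n → Maybe ℕ
dist {n} X u v = search 0 n
  where
  search : ℕ → ℕ → Maybe ℕ
  search k zero    = if reach X k u v then just k else nothing
  search k (suc f) = if reach X k u v then just k else search (suc k) f

_<∞_ : Maybe ℕ → Maybe ℕ → Bool
just a  <∞ just b  = a <ᵇ b
just a  <∞ nothing = true
nothing <∞ _       = false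

nCloser : {n : ℕ} → Graph n → Fin n → Fin n → ℕ
nCloser X u v = count (λ w → dist X w u <∞ dist X w v)

Mostar : {n : ℕ} → Graph n → ℕ
Mostar {n} X = sum (concatMap (λ u → map (λ v →
    if adj X u v ∧ (toℕ u <ᵇ toℕ v)
    then ∣ nCloser X u v - nCloser X v u ∣ else 0) (allFin n)) (allFin n))

-- join G + H on vertex set Fin (s₁ + s₂): first s₁ vertices are G, rest are H
joinAdj : {s₁ s₂ : ℕ} → Graph s₁ → Graph s₂ → Fin (s₁ + s₂) → Fin (s₁ + s₂) → Bool
joinAdj {s₁} G H i j with splitAt s₁ i | splitAt s₁ j
... | inj₁ a | inj₁ b = adj G a b
... | inj₂ a | inj₂ b = adj H a b
... | inj₁ _ | inj₂ _ = true
... | inj₂ _ | inj₁ _ = true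

joinSym : {s₁ s₂ : ℕ} (G : Graph s₁) (H : Graph s₂) → ∀ i j → joinAdj G H i j ≡ joinAdj G H j i
joinSym {s₁} G H i j with splitAt s₁ i | splitAt s₁ j
... | inj₁ a | inj₁ b = sym G a b
... | inj₂ a | inj₂ b = sym H a b
... | inj₁ _ | inj₂ _ = refl
... | inj₂ _ | inj₁ _ = refl

joinIrrefl : {s₁ s₂ : ℕ} (G : Graph s₁) (H : Graph s₂) → ∀ i → joinAdj G H i i ≡ false
joinIrrefl {s₁} G H i with splitAt s₁ i
... | inj₁ a = irrefl G a
... | inj₂ a = irrefl H a

_⊕_ : {s₁ s₂ : ℕ} → Graph s₁ → Graph s₂ → Graph (s₁ + s₂)
G ⊕ H = record { adj = joinAdj G H ; sym = joinSym G H ; irrefl = joinIrrefl G H }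

-- In G + H any two vertices are at distance at most 2, since all of G is
-- joined to all of H. Along an edge uv of a graph of diameter at most 2 the
-- distances d(w,u) and d(w,v) differ by at most one, so
--   n_u(e) - n_v(e) = ∑_w d(w,v) - ∑_w d(w,u),
-- while in such a graph ∑_w d(w,u) = 2(n - 1) - deg u. Hence |n_u - n_v| is
-- |deg u - deg v|, and the Mostar index of the join is the sum of
-- |deg u - deg v| over its edges (its Albertson irregularity). Both G and H being regular, only the s₁s₂
-- edges between G and H contribute, each |(r₁ + s₂) - (s₁ + r₂)|.
module Submission where

open import Defs hiding (sym; irrefl)
open import Data.Nat using (ℕ; _*_; _≥_)
open import Relation.Binary.PropositionalEquality using (_≡_)

module MostarIndex where

  open import Algebra.Properties.CommutativeSemigroup using (interchange)
  open import Data.Bool using (Bool; true; false; _∧_; _∨_; if_then_else_)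
  open import Data.Bool.ListAction using (any)
  open import Data.Bool.Properties using (∨-zeroʳ)
  open import Data.Fin using (Fin; zero; suc; toℕ; splitAt; _↑ˡ_; _↑ʳ_; _≟_)
  open import Data.Fin.Properties
    using (splitAt-↑ˡ; splitAt-↑ʳ; splitAt⁻¹-↑ˡ; splitAt⁻¹-↑ʳ; toℕ-↑ˡ; toℕ-↑ʳ)
  open import Data.Integer as ℤ using (ℤ; _⊖_)
  open import Data.Integer.Properties using (pos-+; m-n≡m⊖n; [1+m]⊖[1+n]≡m⊖n)
  open import Data.Integer.Tactic.RingSolver using (solve-∀)
  open import Data.List using (List; []; _∷_; map; allFin; concatMap; tabulate)
  open import Data.List.Properties using (map-tabulate)
  open import Data.List.Membership.Propositional using (_∈_)
  open import Data.List.Membership.Propositional.Properties using (∈-allFin)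
  open import Data.List.Relation.Unary.Any using (here; there)
  open import Data.Maybe using (Maybe; just; nothing)
  open import Data.Nat using (zero; suc; _+_; _<ᵇ_; ∣_-_∣)
  open import Data.Nat.ListAction using (sum)
  open import Data.Nat.ListAction.Properties using (sum-++)
  open import Data.Nat.Properties
    using (+-0-monoid; +-commutativeSemigroup; +-assoc; +-comm; +-identityʳ; *-identityʳ;
           ∣n-n∣≡0; ∣m+n-m+o∣≡∣n-o∣)
  open import Data.Sum using (inj₁; inj₂)
  open import Relation.Binary.PropositionalEquality
    using (refl; sym; trans; cong; cong₂; subst; module ≡-Reasoning)
  open import Relation.Nullary using (yes; no)
  open import Relation.Nullary.Decidable using (isYes; isYes≗does; dec-true; ⌊⌋-map′)

  open import Algebra.Properties.Monoid.Sum +-0-monoid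
    using (sum-syntax; sum-cong-≗; sum-replicate-zero) renaming (sum to ∑)

  𝟙 : Bool → ℕ
  𝟙 b = if b then 1 else 0

  ∑-const : ∀ n c → ∑[ i < n ] c ≡ n * c
  ∑-const zero    c = refl
  ∑-const (suc n) c = cong (c +_) (∑-const n c)

  ∑-distrib-+ : ∀ {n} (f g : Fin n → ℕ) → ∑[ i < n ] (f i + g i) ≡ ∑ f + ∑ g
  ∑-distrib-+ {zero}  f g = refl
  ∑-distrib-+ {suc n} f g =
    trans (cong (f zero + g zero +_) (∑-distrib-+ (λ i → f (suc i)) (λ i → g (suc i))))
          (interchange +-commutativeSemigroup (f zero) (g zero) _ _)

  ∑-++ : ∀ m {n} (f : Fin (m + n) → ℕ) →
         ∑ f ≡ ∑[ i < m ] f (i ↑ˡ n) + ∑[ j < n ] f (m ↑ʳ j)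
  ∑-++ zero    f = refl
  ∑-++ (suc m) f = trans (cong (f zero +_) (∑-++ m (λ i → f (suc i))))
                         (sym (+-assoc (f zero) _ _))

  ∑-indicator : ∀ {n} (u : Fin n) → ∑[ w < n ] 𝟙 (isYes (w ≟ u)) ≡ 1
  ∑-indicator {suc n} zero    = cong suc (sum-replicate-zero n)
  ∑-indicator {suc n} (suc u) =
    trans (sum-cong-≗ (λ w → cong 𝟙 (⌊⌋-map′ (cong suc) _ (w ≟ u)))) (∑-indicator u)

  sum-tabulate : ∀ {n} (f : Fin n → ℕ) → sum (tabulate f) ≡ ∑ f
  sum-tabulate {zero}  f = refl
  sum-tabulate {suc n} f = cong (f zero +_) (sum-tabulate (λ i → f (suc i)))

  sum-map-allFin : ∀ {n} (f : Fin n → ℕ) → sum (map f (allFin n)) ≡ ∑ f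
  sum-map-allFin f = trans (cong sum (map-tabulate (λ i → i) f)) (sum-tabulate f)

  sum-concatMap : ∀ {A : Set} (f : A → List ℕ) (xs : List A) →
                  sum (concatMap f xs) ≡ sum (map (λ x → sum (f x)) xs)
  sum-concatMap f []       = refl
  sum-concatMap f (x ∷ xs) = trans (sum-++ (f x) (concatMap f xs))
                                   (cong (sum (f x) +_) (sum-concatMap f xs))

  count-∑ : ∀ {n} (p : Fin n → Bool) → count p ≡ ∑[ w < n ] 𝟙 (p w)
  count-∑ p = sum-map-allFin (λ w → 𝟙 (p w))

  m+o≡n+p⇒∣m-n∣≡∣p-o∣ : ∀ m n o p → m + o ≡ n + p → ∣ m - n ∣ ≡ ∣ p - o ∣
  m+o≡n+p⇒∣m-n∣≡∣p-o∣ m n o p eq = begin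
    ∣ m - n ∣             ≡⟨ sym (∣m+n-m+o∣≡∣n-o∣ o m n) ⟩
    ∣ o + m - o + n ∣     ≡⟨ cong₂ ∣_-_∣ (trans (+-comm o m) eq) (+-comm o n) ⟩
    ∣ n + p - n + o ∣     ≡⟨ ∣m+n-m+o∣≡∣n-o∣ n p o ⟩
    ∣ p - o ∣             ∎
    where open ≡-Reasoning

  ∣m+o-n+o∣≡∣m-n∣ : ∀ m n o → ∣ m + o - n + o ∣ ≡ ∣ m - n ∣
  ∣m+o-n+o∣≡∣m-n∣ m n o = trans (cong₂ ∣_-_∣ (+-comm m o) (+-comm n o)) (∣m+n-m+o∣≡∣n-o∣ o m n)

  ∣m⊖n∣≡∣m-n∣ : ∀ m n → ℤ.∣ m ⊖ n ∣ ≡ ∣ m - n ∣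
  ∣m⊖n∣≡∣m-n∣ zero    zero    = refl
  ∣m⊖n∣≡∣m-n∣ zero    (suc n) = refl
  ∣m⊖n∣≡∣m-n∣ (suc m) zero    = refl
  ∣m⊖n∣≡∣m-n∣ (suc m) (suc n) = trans (cong ℤ.∣_∣ ([1+m]⊖[1+n]≡m⊖n m n)) (∣m⊖n∣≡∣m-n∣ m n)

  ∣a-b+c-d∣≡∣c+a-b+d∣ : ∀ a b c d →
    ℤ.∣ ℤ.+ a ℤ.- ℤ.+ b ℤ.+ ℤ.+ c ℤ.- ℤ.+ d ∣ ≡ ∣ c + a - b + d ∣
  ∣a-b+c-d∣≡∣c+a-b+d∣ a b c d = begin
    ℤ.∣ ℤ.+ a ℤ.- ℤ.+ b ℤ.+ ℤ.+ c ℤ.- ℤ.+ d ∣     ≡⟨ cong ℤ.∣_∣ (regroup (ℤ.+ a) (ℤ.+ b) (ℤ.+ c) (ℤ.+ d)) ⟩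
    ℤ.∣ (ℤ.+ c ℤ.+ ℤ.+ a) ℤ.- (ℤ.+ b ℤ.+ ℤ.+ d) ∣ ≡⟨ cong₂ (λ x y → ℤ.∣ x ℤ.- y ∣) (sym (pos-+ c a)) (sym (pos-+ b d)) ⟩
    ℤ.∣ ℤ.+ (c + a) ℤ.- ℤ.+ (b + d) ∣             ≡⟨ cong ℤ.∣_∣ (m-n≡m⊖n (c + a) (b + d)) ⟩
    ℤ.∣ (c + a) ⊖ (b + d) ∣                       ≡⟨ ∣m⊖n∣≡∣m-n∣ (c + a) (b + d) ⟩
    ∣ c + a - b + d ∣                             ∎
    where
    open ≡-Reasoning
    regroup : ∀ (a b c d : ℤ) → a ℤ.- b ℤ.+ c ℤ.- d ≡ (c ℤ.+ a) ℤ.- (b ℤ.+ d)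
    regroup = solve-∀

  isYes-≟-refl : ∀ {n} (w : Fin n) → isYes (w ≟ w) ≡ true
  isYes-≟-refl w = trans (isYes≗does (w ≟ w)) (dec-true (w ≟ w) refl)

  any-∈ : ∀ {A : Set} (p : A → Bool) {xs : List A} {x} → x ∈ xs → p x ≡ true → any p xs ≡ true
  any-∈ p (here refl) px rewrite px = refl
  any-∈ p {y ∷ _} (there x∈xs) px = trans (cong (p y ∨_) (any-∈ p x∈xs px)) (∨-zeroʳ (p y))

  any-false : ∀ {A : Set} (p : A → Bool) (xs : List A) → (∀ x → p x ≡ false) → any p xs ≡ false
  any-false p []       _   = refl
  any-false p (y ∷ ys) ¬p rewrite ¬p y = any-false p ys ¬p

  any-≟-∧ : ∀ {n} (w : Fin n) (p : Fin n → Bool) →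
            any (λ z → isYes (w ≟ z) ∧ p z) (allFin n) ≡ p w
  any-≟-∧ {n} w p with p w in pw
  ... | true  = any-∈ _ (∈-allFin w) (trans (cong (_∧ p w) (isYes-≟-refl w)) pw)
  ... | false = any-false _ (allFin n) vanish
    where
    vanish : ∀ z → isYes (w ≟ z) ∧ p z ≡ false
    vanish z with w ≟ z
    ... | yes refl = pw
    ... | no  _    = refl

  Diameter≤2 : ∀ {n} → Graph n → Set
  Diameter≤2 X = ∀ w u → reach X 2 w u ≡ true

  module _ {n} (X : Graph n) where

    reach-1 : ∀ w u → reach X 1 w u ≡ isYes (w ≟ u) ∨ adj X w u
    reach-1 w u = cong (isYes (w ≟ u) ∨_) (any-≟-∧ w (λ z → adj X z u))

    adj⇒reach-2 : ∀ {w u} → adj X w u ≡ true → reach X 2 w u ≡ true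
    adj⇒reach-2 {w} {u} wu rewrite reach-1 w u | wu | ∨-zeroʳ (isYes (w ≟ u)) = refl

    common-neighbour⇒reach-2 : ∀ {w z u} → adj X w z ≡ true → adj X z u ≡ true →
                               reach X 2 w u ≡ true
    common-neighbour⇒reach-2 {w} {z} {u} wz zu =
      trans (cong (reach X 1 w u ∨_) (any-∈ _ (∈-allFin z) reach-via-z)) (∨-zeroʳ _)
      where
      reach-via-z : reach X 1 w z ∧ adj X z u ≡ true
      reach-via-z rewrite reach-1 w z | wz | ∨-zeroʳ (isYes (w ≟ z)) = zu

    dist₂ : Fin n → Fin n → ℕ
    dist₂ w u = if isYes (w ≟ u) then 0 else if adj X w u then 1 else 2

  first-hit≤2 : ∀ b₀ b₁ b₂ a (rest : Maybe ℕ) → b₁ ≡ b₀ ∨ a → b₂ ≡ true →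
    (if b₀ then just 0 else if b₁ then just 1 else if b₂ then just 2 else rest)
      ≡ just (if b₀ then 0 else if a then 1 else 2)
  first-hit≤2 true  _ _ _     _ _    _    = refl
  first-hit≤2 false _ _ true  _ refl _    = refl
  first-hit≤2 false _ _ false _ refl refl = refl

  -- dist X w u searches the levels 0, …, n; the cases on n expose enough of n
  -- for that search to unfold up to level 2.
  dist≡dist₂ : ∀ {n} (X : Graph n) → Diameter≤2 X → ∀ w u → dist X w u ≡ just (dist₂ X w u)
  dist≡dist₂ {1} X _ zero zero = refl
  dist≡dist₂ {2} X diam w u =
    first-hit≤2 _ _ _ (adj X w u) nothing (reach-1 X w u) (diam w u)
  dist≡dist₂ {suc (suc (suc _))} X diam w u =
    first-hit≤2 _ _ _ (adj X w u) _ (reach-1 X w u) (diam w u)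

  -- Graphs of diameter at most two

  transmission : ∀ {n} → Graph n → Fin n → ℕ
  transmission {n} X u = ∑[ w < n ] dist₂ X w u

  module _ {n} (X : Graph n) where

    dist₂-complement : ∀ u w →
      dist₂ X w u + 𝟙 (adj X u w) + (𝟙 (isYes (w ≟ u)) + 𝟙 (isYes (w ≟ u))) ≡ 2
    dist₂-complement u w with w ≟ u
    ... | yes refl rewrite Graph.irrefl X w = refl
    ... | no  _    rewrite Graph.sym X u w with adj X w u
    ...   | true  = refl
    ...   | false = refl

    transmission-degree : ∀ u → transmission X u + (degree X u + 2) ≡ n * 2
    transmission-degree u = begin
      transmission X u + (degree X u + 2)
        ≡⟨ cong₂ (λ d i → transmission X u + (d + (i + i))) (count-∑ (adj X u)) (sym (∑-indicator u)) ⟩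
      ∑ (λ w → dist₂ X w u) + (∑ (λ w → 𝟙 (adj X u w)) + (∑ I + ∑ I))
        ≡⟨ sym (+-assoc (∑ (λ w → dist₂ X w u)) _ _) ⟩
      ∑ (λ w → dist₂ X w u) + ∑ (λ w → 𝟙 (adj X u w)) + (∑ I + ∑ I)
        ≡⟨ sym (cong₂ _+_ (∑-distrib-+ (λ w → dist₂ X w u) (λ w → 𝟙 (adj X u w))) (∑-distrib-+ I I)) ⟩
      ∑ (λ w → dist₂ X w u + 𝟙 (adj X u w)) + ∑ (λ w → I w + I w)
        ≡⟨ sym (∑-distrib-+ (λ w → dist₂ X w u + 𝟙 (adj X u w)) (λ w → I w + I w)) ⟩
      ∑ (λ w → dist₂ X w u + 𝟙 (adj X u w) + (I w + I w))
        ≡⟨ sum-cong-≗ (dist₂-complement u) ⟩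
      ∑[ w < n ] 2
        ≡⟨ ∑-const n 2 ⟩
      n * 2 ∎
      where
      open ≡-Reasoning
      I : Fin n → ℕ
      I w = 𝟙 (isYes (w ≟ u))

    -- Across an edge the two distances differ by at most one.
    closer-balance : ∀ {u v} → adj X u v ≡ true → ∀ w →
      𝟙 (dist₂ X w u <ᵇ dist₂ X w v) + dist₂ X w u ≡ 𝟙 (dist₂ X w v <ᵇ dist₂ X w u) + dist₂ X w v
    closer-balance {u} {v} uv w with w ≟ u | w ≟ v
    ... | yes refl | yes refl with () ← trans (sym uv) (Graph.irrefl X w)
    ... | yes refl | no _ rewrite uv = refl
    ... | no _ | yes refl rewrite Graph.sym X w u | uv = refl
    ... | no _ | no _ with adj X w u | adj X w v
    ...   | true  | true  = refl
    ...   | true  | false = refl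
    ...   | false | true  = refl
    ...   | false | false = refl

  module _ {n} (X : Graph n) (diam : Diameter≤2 X) where

    nCloser≡∑ : ∀ u v → nCloser X u v ≡ ∑[ w < n ] 𝟙 (dist₂ X w u <ᵇ dist₂ X w v)
    nCloser≡∑ u v = trans (count-∑ (λ w → dist X w u <∞ dist X w v)) (sum-cong-≗ closer)
      where
      closer : ∀ w → 𝟙 (dist X w u <∞ dist X w v) ≡ 𝟙 (dist₂ X w u <ᵇ dist₂ X w v)
      closer w rewrite dist≡dist₂ X diam w u | dist≡dist₂ X diam w v = refl

    nCloser-transmission : ∀ {u v} → adj X u v ≡ true →
      nCloser X u v + transmission X u ≡ nCloser X v u + transmission X v
    nCloser-transmission {u} {v} uv = begin
      nCloser X u v + transmission X u
        ≡⟨ cong (_+ transmission X u) (nCloser≡∑ u v) ⟩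
      ∑ (λ w → 𝟙 (dist₂ X w u <ᵇ dist₂ X w v)) + transmission X u
        ≡⟨ sym (∑-distrib-+ (λ w → 𝟙 (dist₂ X w u <ᵇ dist₂ X w v)) (λ w → dist₂ X w u)) ⟩
      ∑ (λ w → 𝟙 (dist₂ X w u <ᵇ dist₂ X w v) + dist₂ X w u)
        ≡⟨ sum-cong-≗ (closer-balance X uv) ⟩
      ∑ (λ w → 𝟙 (dist₂ X w v <ᵇ dist₂ X w u) + dist₂ X w v)
        ≡⟨ ∑-distrib-+ (λ w → 𝟙 (dist₂ X w v <ᵇ dist₂ X w u)) (λ w → dist₂ X w v) ⟩
      ∑ (λ w → 𝟙 (dist₂ X w v <ᵇ dist₂ X w u)) + transmission X v
        ≡⟨ cong (_+ transmission X v) (sym (nCloser≡∑ v u)) ⟩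
      nCloser X v u + transmission X v ∎
      where open ≡-Reasoning

    ∣nCloser-nCloser∣≡∣degree-degree∣ : ∀ {u v} → adj X u v ≡ true →
      ∣ nCloser X u v - nCloser X v u ∣ ≡ ∣ degree X u - degree X v ∣
    ∣nCloser-nCloser∣≡∣degree-degree∣ {u} {v} uv = begin
      ∣ nCloser X u v - nCloser X v u ∣
        ≡⟨ m+o≡n+p⇒∣m-n∣≡∣p-o∣ _ _ (transmission X u) (transmission X v) (nCloser-transmission uv) ⟩
      ∣ transmission X v - transmission X u ∣
        ≡⟨ m+o≡n+p⇒∣m-n∣≡∣p-o∣ (transmission X v) (transmission X u) (degree X v + 2) (degree X u + 2)
             (trans (transmission-degree X v) (sym (transmission-degree X u))) ⟩
      ∣ degree X u + 2 - degree X v + 2 ∣ ≡⟨ ∣m+o-n+o∣≡∣m-n∣ (degree X u) (degree X v) 2 ⟩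
      ∣ degree X u - degree X v ∣         ∎
      where open ≡-Reasoning

  onEdge : ∀ {n} → Graph n → (Fin n → Fin n → ℕ) → Fin n → Fin n → ℕ
  onEdge X f u v = if adj X u v ∧ (toℕ u <ᵇ toℕ v) then f u v else 0

  ∑-edges : ∀ {n} → Graph n → (Fin n → Fin n → ℕ) → ℕ
  ∑-edges {n} X f = ∑[ u < n ] ∑[ v < n ] onEdge X f u v

  albertson : ∀ {n} → Graph n → ℕ
  albertson X = ∑-edges X (λ u v → ∣ degree X u - degree X v ∣)

  Mostar≡∑-edges : ∀ {n} (X : Graph n) →
    Mostar X ≡ ∑-edges X (λ u v → ∣ nCloser X u v - nCloser X v u ∣)
  Mostar≡∑-edges {n} X =
    trans (sum-concatMap (λ u → map (e u) (allFin n)) (allFin n))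
          (trans (sum-map-allFin (λ u → sum (map (e u) (allFin n))))
                 (sum-cong-≗ (λ u → sum-map-allFin (e u))))
    where
    e : Fin n → Fin n → ℕ
    e = onEdge X (λ u v → ∣ nCloser X u v - nCloser X v u ∣)

  ∑-edges-cong : ∀ {n} (X : Graph n) {f g : Fin n → Fin n → ℕ} →
    (∀ {u v} → adj X u v ≡ true → f u v ≡ g u v) → ∑-edges X f ≡ ∑-edges X g
  ∑-edges-cong X {f} {g} f≡g = sum-cong-≗ (λ u → sum-cong-≗ (onEdge-cong u))
    where
    onEdge-cong : ∀ u v → onEdge X f u v ≡ onEdge X g u v
    onEdge-cong u v with adj X u v in uv
    ... | true  = cong (λ z → if toℕ u <ᵇ toℕ v then z else 0) (f≡g uv)
    ... | false = refl

  ∑-edges-zero : ∀ {n} (X : Graph n) {f : Fin n → Fin n → ℕ} →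
    (∀ u v → f u v ≡ 0) → ∑-edges X f ≡ 0
  ∑-edges-zero {n} X {f} f≡0 =
    trans (sum-cong-≗ (λ u → trans (sum-cong-≗ (onEdge-zero u)) (sum-replicate-zero n)))
          (sum-replicate-zero n)
    where
    onEdge-zero : ∀ u v → onEdge X f u v ≡ 0
    onEdge-zero u v with adj X u v ∧ (toℕ u <ᵇ toℕ v)
    ... | true  = f≡0 u v
    ... | false = refl

  Mostar≡albertson : ∀ {n} (X : Graph n) → Diameter≤2 X → Mostar X ≡ albertson X
  Mostar≡albertson X diam =
    trans (Mostar≡∑-edges X) (∑-edges-cong X (∣nCloser-nCloser∣≡∣degree-degree∣ X diam))

  albertson-regular : ∀ {n r} (X : Graph n) → Regular X r → albertson X ≡ 0
  albertson-regular {r = r} X reg =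
    ∑-edges-zero X (λ u v → trans (cong₂ ∣_-_∣ (reg u) (reg v)) (∣n-n∣≡0 r))

  -- The join

  toℕ<ᵇm+k : ∀ {m} (i : Fin m) k → (toℕ i <ᵇ m + k) ≡ true
  toℕ<ᵇm+k zero    k = refl
  toℕ<ᵇm+k (suc i) k = toℕ<ᵇm+k i k

  m+k≮ᵇtoℕ : ∀ {m} (i : Fin m) k → (m + k <ᵇ toℕ i) ≡ false
  m+k≮ᵇtoℕ zero    k = refl
  m+k≮ᵇtoℕ (suc i) k = m+k≮ᵇtoℕ i k

  +-cancelˡ-<ᵇ : ∀ m a b → (m + a <ᵇ m + b) ≡ (a <ᵇ b)
  +-cancelˡ-<ᵇ zero    a b = refl
  +-cancelˡ-<ᵇ (suc m) a b = +-cancelˡ-<ᵇ m a b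

  module _ {s₁ s₂} (G : Graph s₁) (H : Graph s₂) where

    ι₁ : Fin s₁ → Fin (s₁ + s₂)
    ι₁ i = i ↑ˡ s₂

    ι₂ : Fin s₂ → Fin (s₁ + s₂)
    ι₂ j = s₁ ↑ʳ j

    data Side : Fin (s₁ + s₂) → Set where
      left  : ∀ i → Side (ι₁ i)
      right : ∀ j → Side (ι₂ j)

    side : ∀ x → Side x
    side x with splitAt s₁ x in eq
    ... | inj₁ i = subst Side (splitAt⁻¹-↑ˡ eq) (left i)
    ... | inj₂ j = subst Side (splitAt⁻¹-↑ʳ eq) (right j)

    adj-ι₁ι₁ : ∀ i j → adj (G ⊕ H) (ι₁ i) (ι₁ j) ≡ adj G i j
    adj-ι₁ι₁ i j rewrite splitAt-↑ˡ s₁ i s₂ | splitAt-↑ˡ s₁ j s₂ = refl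

    adj-ι₁ι₂ : ∀ i j → adj (G ⊕ H) (ι₁ i) (ι₂ j) ≡ true
    adj-ι₁ι₂ i j rewrite splitAt-↑ˡ s₁ i s₂ | splitAt-↑ʳ s₁ s₂ j = refl

    adj-ι₂ι₁ : ∀ i j → adj (G ⊕ H) (ι₂ i) (ι₁ j) ≡ true
    adj-ι₂ι₁ i j rewrite splitAt-↑ʳ s₁ s₂ i | splitAt-↑ˡ s₁ j s₂ = refl

    adj-ι₂ι₂ : ∀ i j → adj (G ⊕ H) (ι₂ i) (ι₂ j) ≡ adj H i j
    adj-ι₂ι₂ i j rewrite splitAt-↑ʳ s₁ s₂ i | splitAt-↑ʳ s₁ s₂ j = refl

    ⊕-diameter≤2 : Fin s₁ → Fin s₂ → Diameter≤2 (G ⊕ H)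
    ⊕-diameter≤2 z₁ z₂ w u with side w | side u
    ... | left  i | left  j = common-neighbour⇒reach-2 (G ⊕ H) (adj-ι₁ι₂ i z₂) (adj-ι₂ι₁ z₂ j)
    ... | left  i | right j = adj⇒reach-2 (G ⊕ H) (adj-ι₁ι₂ i j)
    ... | right i | left  j = adj⇒reach-2 (G ⊕ H) (adj-ι₂ι₁ i j)
    ... | right i | right j = common-neighbour⇒reach-2 (G ⊕ H) (adj-ι₂ι₁ i z₁) (adj-ι₁ι₂ z₁ j)

    degree-ι₁ : ∀ i → degree (G ⊕ H) (ι₁ i) ≡ degree G i + s₂
    degree-ι₁ i = begin
      degree (G ⊕ H) (ι₁ i)
        ≡⟨ trans (count-∑ (adj (G ⊕ H) (ι₁ i))) (∑-++ s₁ (λ w → 𝟙 (adj (G ⊕ H) (ι₁ i) w))) ⟩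
      ∑ (λ j → 𝟙 (adj (G ⊕ H) (ι₁ i) (ι₁ j))) + ∑ (λ j → 𝟙 (adj (G ⊕ H) (ι₁ i) (ι₂ j)))
        ≡⟨ cong₂ _+_ (sum-cong-≗ (λ j → cong 𝟙 (adj-ι₁ι₁ i j))) (sum-cong-≗ (λ j → cong 𝟙 (adj-ι₁ι₂ i j))) ⟩
      ∑ (λ j → 𝟙 (adj G i j)) + ∑[ j < s₂ ] 1
        ≡⟨ cong₂ _+_ (sym (count-∑ (adj G i))) (trans (∑-const s₂ 1) (*-identityʳ s₂)) ⟩
      degree G i + s₂ ∎
      where open ≡-Reasoning

    degree-ι₂ : ∀ j → degree (G ⊕ H) (ι₂ j) ≡ s₁ + degree H j
    degree-ι₂ j = begin
      degree (G ⊕ H) (ι₂ j)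
        ≡⟨ trans (count-∑ (adj (G ⊕ H) (ι₂ j))) (∑-++ s₁ (λ w → 𝟙 (adj (G ⊕ H) (ι₂ j) w))) ⟩
      ∑ (λ i → 𝟙 (adj (G ⊕ H) (ι₂ j) (ι₁ i))) + ∑ (λ i → 𝟙 (adj (G ⊕ H) (ι₂ j) (ι₂ i)))
        ≡⟨ cong₂ _+_ (sum-cong-≗ (λ i → cong 𝟙 (adj-ι₂ι₁ j i))) (sum-cong-≗ (λ i → cong 𝟙 (adj-ι₂ι₂ j i))) ⟩
      ∑[ i < s₁ ] 1 + ∑ (λ i → 𝟙 (adj H j i))
        ≡⟨ cong₂ _+_ (trans (∑-const s₁ 1) (*-identityʳ s₁)) (sym (count-∑ (adj H j))) ⟩
      s₁ + degree H j ∎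
      where open ≡-Reasoning

    module _ (f : Fin (s₁ + s₂) → Fin (s₁ + s₂) → ℕ) where

      onEdge-ι₁ι₁ : ∀ i j → onEdge (G ⊕ H) f (ι₁ i) (ι₁ j) ≡ onEdge G (λ a b → f (ι₁ a) (ι₁ b)) i j
      onEdge-ι₁ι₁ i j rewrite adj-ι₁ι₁ i j | toℕ-↑ˡ i s₂ | toℕ-↑ˡ j s₂ = refl

      onEdge-ι₁ι₂ : ∀ i j → onEdge (G ⊕ H) f (ι₁ i) (ι₂ j) ≡ f (ι₁ i) (ι₂ j)
      onEdge-ι₁ι₂ i j rewrite adj-ι₁ι₂ i j | toℕ-↑ˡ i s₂ | toℕ-↑ʳ s₁ j | toℕ<ᵇm+k i (toℕ j) = refl

      onEdge-ι₂ι₁ : ∀ i j → onEdge (G ⊕ H) f (ι₂ i) (ι₁ j) ≡ 0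
      onEdge-ι₂ι₁ i j rewrite adj-ι₂ι₁ i j | toℕ-↑ʳ s₁ i | toℕ-↑ˡ j s₂ | m+k≮ᵇtoℕ j (toℕ i) = refl

      onEdge-ι₂ι₂ : ∀ i j → onEdge (G ⊕ H) f (ι₂ i) (ι₂ j) ≡ onEdge H (λ a b → f (ι₂ a) (ι₂ b)) i j
      onEdge-ι₂ι₂ i j
        rewrite adj-ι₂ι₂ i j | toℕ-↑ʳ s₁ i | toℕ-↑ʳ s₁ j | +-cancelˡ-<ᵇ s₁ (toℕ i) (toℕ j) = refl

      ∑-edges-⊕ : ∑-edges (G ⊕ H) f ≡
        ∑-edges G (λ i j → f (ι₁ i) (ι₁ j)) + ∑[ i < s₁ ] ∑[ j < s₂ ] f (ι₁ i) (ι₂ j)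
          + ∑-edges H (λ i j → f (ι₂ i) (ι₂ j))
      ∑-edges-⊕ = begin
        ∑-edges (G ⊕ H) f
          ≡⟨ ∑-++ s₁ (λ u → ∑ (onEdge (G ⊕ H) f u)) ⟩
        ∑ (λ i → ∑ (onEdge (G ⊕ H) f (ι₁ i))) + ∑ (λ j → ∑ (onEdge (G ⊕ H) f (ι₂ j)))
          ≡⟨ cong₂ _+_ (sum-cong-≗ (λ i → ∑-++ s₁ (onEdge (G ⊕ H) f (ι₁ i))))
                       (sum-cong-≗ (λ j → ∑-++ s₁ (onEdge (G ⊕ H) f (ι₂ j)))) ⟩
        ∑ (λ i → ∑ (λ k → onEdge (G ⊕ H) f (ι₁ i) (ι₁ k)) + ∑ (λ k → onEdge (G ⊕ H) f (ι₁ i) (ι₂ k)))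
          + ∑ (λ j → ∑ (λ k → onEdge (G ⊕ H) f (ι₂ j) (ι₁ k)) + ∑ (λ k → onEdge (G ⊕ H) f (ι₂ j) (ι₂ k)))
          ≡⟨ cong₂ _+_ (sum-cong-≗ from-G) (sum-cong-≗ from-H) ⟩
        ∑ (λ i → ∑ (onEdge G fG i) + ∑ (λ k → f (ι₁ i) (ι₂ k))) + ∑-edges H fH
          ≡⟨ cong (_+ ∑-edges H fH) (∑-distrib-+ (λ i → ∑ (onEdge G fG i)) (λ i → ∑ (λ k → f (ι₁ i) (ι₂ k)))) ⟩
        ∑-edges G fG + ∑[ i < s₁ ] ∑[ j < s₂ ] f (ι₁ i) (ι₂ j) + ∑-edges H fH ∎
        where
        open ≡-Reasoning
        fG : Fin s₁ → Fin s₁ → ℕ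
        fG i j = f (ι₁ i) (ι₁ j)
        fH : Fin s₂ → Fin s₂ → ℕ
        fH i j = f (ι₂ i) (ι₂ j)
        from-G : ∀ i →
          ∑ (λ k → onEdge (G ⊕ H) f (ι₁ i) (ι₁ k)) + ∑ (λ k → onEdge (G ⊕ H) f (ι₁ i) (ι₂ k))
            ≡ ∑ (onEdge G fG i) + ∑ (λ k → f (ι₁ i) (ι₂ k))
        from-G i = cong₂ _+_ (sum-cong-≗ (onEdge-ι₁ι₁ i)) (sum-cong-≗ (onEdge-ι₁ι₂ i))
        from-H : ∀ j →
          ∑ (λ k → onEdge (G ⊕ H) f (ι₂ j) (ι₁ k)) + ∑ (λ k → onEdge (G ⊕ H) f (ι₂ j) (ι₂ k))
            ≡ ∑ (onEdge H fH j)
        from-H j = cong₂ _+_ (trans (sum-cong-≗ (onEdge-ι₂ι₁ j)) (sum-replicate-zero s₁))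
                             (sum-cong-≗ (onEdge-ι₂ι₂ j))

    albertson-⊕ : albertson (G ⊕ H) ≡
      albertson G + ∑[ i < s₁ ] ∑[ j < s₂ ] ∣ degree G i + s₂ - s₁ + degree H j ∣ + albertson H
    albertson-⊕ =
      trans (∑-edges-⊕ (λ u v → ∣ degree (G ⊕ H) u - degree (G ⊕ H) v ∣))
            (cong₂ _+_ (cong₂ _+_ within-G across) within-H)
      where
      within-G : ∑-edges G (λ i j → ∣ degree (G ⊕ H) (ι₁ i) - degree (G ⊕ H) (ι₁ j) ∣) ≡ albertson G
      within-G = ∑-edges-cong G (λ {i} {j} _ →
        trans (cong₂ ∣_-_∣ (degree-ι₁ i) (degree-ι₁ j)) (∣m+o-n+o∣≡∣m-n∣ (degree G i) (degree G j) s₂))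
      across : ∑[ i < s₁ ] ∑[ j < s₂ ] ∣ degree (G ⊕ H) (ι₁ i) - degree (G ⊕ H) (ι₂ j) ∣
             ≡ ∑[ i < s₁ ] ∑[ j < s₂ ] ∣ degree G i + s₂ - s₁ + degree H j ∣
      across = sum-cong-≗ (λ i → sum-cong-≗ (λ j → cong₂ ∣_-_∣ (degree-ι₁ i) (degree-ι₂ j)))
      within-H : ∑-edges H (λ i j → ∣ degree (G ⊕ H) (ι₂ i) - degree (G ⊕ H) (ι₂ j) ∣) ≡ albertson H
      within-H = ∑-edges-cong H (λ {i} {j} _ →
        trans (cong₂ ∣_-_∣ (degree-ι₂ i) (degree-ι₂ j)) (∣m+n-m+o∣≡∣n-o∣ s₁ (degree H i) (degree H j)))

  Mostar-⊕-regular : ∀ {s₁ s₂ r₁ r₂} (G : Graph s₁) (H : Graph s₂) →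
    Fin s₁ → Fin s₂ → Regular G r₁ → Regular H r₂ →
    Mostar (G ⊕ H) ≡ s₁ * (s₂ * ∣ r₁ + s₂ - s₁ + r₂ ∣)
  Mostar-⊕-regular {s₁} {s₂} {r₁} {r₂} G H z₁ z₂ G-regular H-regular = begin
    Mostar (G ⊕ H)
      ≡⟨ Mostar≡albertson (G ⊕ H) (⊕-diameter≤2 G H z₁ z₂) ⟩
    albertson (G ⊕ H)
      ≡⟨ albertson-⊕ G H ⟩
    albertson G + ∑[ i < s₁ ] ∑[ j < s₂ ] ∣ degree G i + s₂ - s₁ + degree H j ∣ + albertson H
      ≡⟨ cong₂ _+_ (cong₂ _+_ (albertson-regular G G-regular) across) (albertson-regular H H-regular) ⟩
    s₁ * (s₂ * c) + 0
      ≡⟨ +-identityʳ _ ⟩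
    s₁ * (s₂ * c) ∎
    where
    open ≡-Reasoning
    c : ℕ
    c = ∣ r₁ + s₂ - s₁ + r₂ ∣
    across : ∑[ i < s₁ ] ∑[ j < s₂ ] ∣ degree G i + s₂ - s₁ + degree H j ∣ ≡ s₁ * (s₂ * c)
    across = trans (sum-cong-≗ (λ i → trans (sum-cong-≗ (λ j → cong₂ (λ a b → ∣ a + s₂ - s₁ + b ∣)
                                                                  (G-regular i) (H-regular j)))
                                            (∑-const s₂ c)))
                   (∑-const s₁ (s₂ * c))

open MostarIndex using (Mostar-⊕-regular; ∣a-b+c-d∣≡∣c+a-b+d∣)
open import Data.Integer using (+_; _+_; _-_; ∣_∣)
open import Data.Fin using (fromℕ<)
open import Data.Nat.Properties using (*-assoc)
open import Relation.Binary.PropositionalEquality using (trans; cong; sym)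

corollary3 : (s₁ s₂ r₁ r₂ : ℕ) → s₁ ≥ 1 → s₂ ≥ 1 →
    (G : Graph s₁) → (H : Graph s₂) → Regular G r₁ → Regular H r₂ →
    Mostar (G ⊕ H) ≡ s₁ * s₂ * ∣ + s₂ - + s₁ + + r₁ - + r₂ ∣
corollary3 s₁ s₂ r₁ r₂ s₁≥1 s₂≥1 G H G-regular H-regular =
  trans (Mostar-⊕-regular G H (fromℕ< s₁≥1) (fromℕ< s₂≥1) G-regular H-regular)
    (trans (sym (*-assoc s₁ s₂ _)) (cong (s₁ * s₂ *_) (sym (∣a-b+c-d∣≡∣c+a-b+d∣ s₂ s₁ r₁ r₂))))
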